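{- Let $\langle S,\phi\rangle$ be a reduced closure system, $x\in S$ and $X\subseteq S$. If $x\triangleleft X$, then there exists $Y\subseteq S$ such that $x\triangleleft Y$, $Y\ll X$, and $Y$ is a minimal cover of $x$.
   Context: A closure system is a pair $\langle S,\phi\rangle$ with $S$ a finite nonempty set and $\phi:2^S\to2^S$ a closure operator (extensive, monotone, idempotent). It is reduced if $\phi(\{i\})=\phi(\{j\})$ implies $i=j$. Write $\phi(y)$ for $\phi(\{y\})$. For $X,Y\subseteq S$, $X\ll Y$ means: for every $x\in X$ there is $y\in Y$ with $x\in\phi(y)$. For $x\in S$ and $X\subseteq S$, $X$ is a cover of $x$, written $x\triangleleft X$, if $x\in\phi(X)\setminus\bigcup_{x'\in X}\phi(x')$. A cover $Y$ of $x$ is a minimal cover of $x$ if for every cover $Z$ of $x$, $Z\ll Y$ implies $Y\subseteq Z$. -}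

module Defs where

open import Data.Nat using (ℕ; suc)
open import Data.Fin using (Fin)
open import Data.Fin.Subset using (Subset; _⊆_; _∈_; _∉_; ⁅_⁆)
open import Data.Product using (Σ; ∃; _×_; _,_)
open import Relation.Binary.PropositionalEquality using (_≡_)

-- A closure system on a finite nonempty set S, represented as Fin n with n = suc m.
record ClosureSystem (n : ℕ) : Set where
  field
    φ          : Subset n → Subset n
    extensive  : ∀ X → X ⊆ φ X
    monotone   : ∀ {X Y} → X ⊆ Y → φ X ⊆ φ Y
    idempotent : ∀ X → φ (φ X) ≡ φ X

module _ {n : ℕ} (C : ClosureSystem n) where
  open ClosureSystem C

  φ₁ : Fin n → Subset n
  φ₁ y = φ ⁅ y ⁆

  Reduced : Set
  Reduced = ∀ i j → φ₁ i ≡ φ₁ j → i ≡ j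

  _≪_ : Subset n → Subset n → Set
  X ≪ Y = ∀ x → x ∈ X → ∃ λ y → y ∈ Y × x ∈ φ₁ y

  _◁_ : Fin n → Subset n → Set
  x ◁ X = x ∈ φ X × (∀ x' → x' ∈ X → x ∉ φ₁ x')

  MinimalCover : Fin n → Subset n → Set
  MinimalCover x Y = x ◁ Y × (∀ Z → x ◁ Z → Z ≪ Y → Y ⊆ Z)

-- Among the covers Y ≪ X of x, pick one minimising first the size of its down-set
-- ↓ Y = ⋃_{y ∈ Y} φ(y) and then the size of Y itself. Size-minimality makes Y an
-- antichain of the preorder "a ∈ φ(b)": a comparable pair could be thinned out without
-- enlarging ↓ Y. If a cover Z satisfies Z ≪ Y then ↓ Z ⊆ ↓ Y, so down-set minimality
-- forces ↓ Z = ↓ Y. Hence every y ∈ Y lies in φ(z) for some z ∈ Z, and z ∈ φ(y′) for some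
-- y′ ∈ Y; the antichain property gives y = y′, so φ(y) = φ(z) and reducedness gives y = z.
module Submission where

open import Defs
open import Level using (Level)
open import Data.Nat using (ℕ; suc; _≤_; _<_; _≤?_; _<?_)
open import Data.Nat.Properties using (≤-refl; ≤-trans; ≮⇒≥; ≤⇒≯)
open import Data.Nat.Induction using (<-wellFounded)
open import Induction.WellFounded using (Acc; acc)
open import Data.Fin using (Fin; _≟_)
open import Data.Fin.Subset using (Subset; _⊆_; _∈_; ⁅_⁆; ∣_∣; _-_)
open import Data.Fin.Subset.Properties
  using (_∈?_; anySubset?; ⊆-refl; x∈⁅x⁆; x∈⁅y⁆⇒x≡y; ⊆-antisym; p⊆q⇒∣p∣≤∣q∣; p⊂q⇒∣p∣<∣q∣;
         x∈p⇒∣p-x∣<∣p∣; x∈p∧x≢y⇒x∈p-y; p─q⊆p)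
open import Data.Fin.Properties using (any?; all?)
open import Data.Vec using (tabulate)
open import Data.Vec.Properties using (lookup∘tabulate; []=⇒lookup; lookup⇒[]=)
open import Data.Bool using (true)
open import Data.Product using (∃; _×_; _,_)
open import Data.Empty using (⊥-elim)
open import Function using (_∘_)
open import Relation.Nullary using (Dec; yes; no; does; ¬?)
open import Relation.Nullary.Decidable using (dec-true; _×-dec_; _→-dec_)
open import Relation.Unary using (Pred; Decidable)
open import Relation.Binary.PropositionalEquality using (_≡_; _≢_; refl; sym; trans; subst)

private
  variable
    ℓ : Level
    n : ℕ

x∈p⇒⁅x⁆⊆p : {x : Fin n} {p : Subset n} → x ∈ p → ⁅ x ⁆ ⊆ p
x∈p⇒⁅x⁆⊆p {x = x} x∈p y∈ = subst (_∈ _) (sym (x∈⁅y⁆⇒x≡y x y∈)) x∈p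

p⊆q∧∣q∣≤∣p∣⇒q⊆p : {p q : Subset n} → p ⊆ q → ∣ q ∣ ≤ ∣ p ∣ → q ⊆ p
p⊆q∧∣q∣≤∣p∣⇒q⊆p {p = p} {q} p⊆q ∣q∣≤∣p∣ {s} s∈q with s ∈? p
... | yes s∈p = s∈p
... | no  s∉p = ⊥-elim (≤⇒≯ ∣q∣≤∣p∣ (p⊂q⇒∣p∣<∣q∣ (p⊆q , s , s∈q , s∉p)))

module _ {P : Pred (Fin n) ℓ} (P? : Decidable P) where

  fromDecidable : Subset n
  fromDecidable = tabulate (does ∘ P?)

  ∈-fromDecidable⁺ : ∀ {s} → P s → s ∈ fromDecidable
  ∈-fromDecidable⁺ {s} p =
    lookup⇒[]= s fromDecidable (trans (lookup∘tabulate (does ∘ P?) s) (dec-true (P? s) p))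

  ∈-fromDecidable⁻ : ∀ {s} → s ∈ fromDecidable → P s
  ∈-fromDecidable⁻ {s} s∈ = witness (P? s) (trans (sym (lookup∘tabulate (does ∘ P?) s)) ([]=⇒lookup s∈))
    where
    witness : ∀ {A : Set ℓ} (a? : Dec A) → does a? ≡ true → A
    witness (yes a) _ = a

argmin : {P : Pred (Subset n) ℓ} → Decidable P →
         (f : Subset n → ℕ) → ∃ P → ∃ λ Y → P Y × (∀ Z → P Z → f Y ≤ f Z)
argmin {P = P} P? f (Y , pY) = descend Y pY (<-wellFounded (f Y))
  where
  descend : ∀ Y → P Y → Acc _<_ (f Y) → ∃ λ Y → P Y × (∀ Z → P Z → f Y ≤ f Z)
  descend Y pY (acc smaller) with anySubset? (λ Z → P? Z ×-dec (f Z <? f Y))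
  ... | yes (Z , pZ , fZ<fY) = descend Z pZ (smaller fZ<fY)
  ... | no  ∄Z = Y , pY , λ Z pZ → ≮⇒≥ (λ fZ<fY → ∄Z (Z , pZ , fZ<fY))

LexMinimal : Pred (Subset n) ℓ → (f g : Subset n → ℕ) → Subset n → Set ℓ
LexMinimal P f g Y = P Y × (∀ Z → P Z → f Y ≤ f Z) × (∀ Z → P Z → f Z ≤ f Y → g Y ≤ g Z)

lex-argmin : {P : Pred (Subset n) ℓ} → Decidable P →
             (f g : Subset n → ℕ) → ∃ P → ∃ (LexMinimal P f g)
lex-argmin P? f g p with argmin P? f p
... | Y₀ , pY₀ , f-min with argmin (λ Z → P? Z ×-dec (f Z ≤? f Y₀)) g (Y₀ , pY₀ , ≤-refl)
... | Y , (pY , fY≤fY₀) , g-min =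
  Y , pY , (λ Z pZ → ≤-trans fY≤fY₀ (f-min Z pZ)) ,
  λ Z pZ fZ≤fY → g-min Z (pZ , ≤-trans fZ≤fY fY≤fY₀)

module _ {n : ℕ} (C : ClosureSystem n) where
  open ClosureSystem C

  ⊆φ⇒φ⊆φ : ∀ {A B} → A ⊆ φ B → φ A ⊆ φ B
  ⊆φ⇒φ⊆φ {B = B} A⊆φB s∈ = subst (_ ∈_) (idempotent B) (monotone A⊆φB s∈)

  ∈-φ₁ : ∀ y → y ∈ φ₁ C y
  ∈-φ₁ y = extensive ⁅ y ⁆ (x∈⁅x⁆ y)

  ∈-φ₁-trans : ∀ {a b c} → a ∈ φ₁ C b → b ∈ φ₁ C c → a ∈ φ₁ C c
  ∈-φ₁-trans a∈φb b∈φc = ⊆φ⇒φ⊆φ (x∈p⇒⁅x⁆⊆p b∈φc) a∈φb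

  ∈-φ₁-antisym : ∀ {a b} → a ∈ φ₁ C b → b ∈ φ₁ C a → φ₁ C a ≡ φ₁ C b
  ∈-φ₁-antisym a∈φb b∈φa = ⊆-antisym (⊆φ⇒φ⊆φ (x∈p⇒⁅x⁆⊆p a∈φb)) (⊆φ⇒φ⊆φ (x∈p⇒⁅x⁆⊆p b∈φa))

  ⊆⇒≪ : ∀ {A B} → A ⊆ B → _≪_ C A B
  ⊆⇒≪ A⊆B a a∈ = a , A⊆B a∈ , ∈-φ₁ a

  ≪-trans : ∀ {A B D} → _≪_ C A B → _≪_ C B D → _≪_ C A D
  ≪-trans A≪B B≪D a a∈A with A≪B a a∈A
  ... | b , b∈B , a∈φb with B≪D b b∈B
  ... | d , d∈D , b∈φd = d , d∈D , ∈-φ₁-trans a∈φb b∈φd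

  ≪? : ∀ A B → Dec (_≪_ C A B)
  ≪? A B = all? (λ a → (a ∈? A) →-dec any? (λ b → (b ∈? B) ×-dec (a ∈? φ₁ C b)))

  ◁? : ∀ x Y → Dec (_◁_ C x Y)
  ◁? x Y = (x ∈? φ Y) ×-dec all? (λ y → (y ∈? Y) →-dec ¬? (x ∈? φ₁ C y))

  ◁-remove : ∀ {x Y y₁ y₂} → y₁ ∈ φ₁ C y₂ → y₂ ∈ Y → y₂ ≢ y₁ → _◁_ C x Y → _◁_ C x (Y - y₁)
  ◁-remove {x} {Y} {y₁} {y₂} y₁∈φy₂ y₂∈Y y₂≢y₁ (x∈φY , x∉φy) =
    ⊆φ⇒φ⊆φ Y⊆φ[Y-y₁] x∈φY , λ y y∈ → x∉φy y (p─q⊆p Y ⁅ y₁ ⁆ y∈)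
    where
    Y⊆φ[Y-y₁] : Y ⊆ φ (Y - y₁)
    Y⊆φ[Y-y₁] {y} y∈Y with y ≟ y₁
    ... | yes refl = monotone (x∈p⇒⁅x⁆⊆p (x∈p∧x≢y⇒x∈p-y y₂∈Y y₂≢y₁)) y₁∈φy₂
    ... | no  y≢y₁ = extensive (Y - y₁) (x∈p∧x≢y⇒x∈p-y y∈Y y≢y₁)

  Below : Subset n → Pred (Fin n) _
  Below Y s = ∃ λ y → y ∈ Y × s ∈ φ₁ C y

  below? : ∀ Y → Decidable (Below Y)
  below? Y s = any? (λ y → (y ∈? Y) ×-dec (s ∈? φ₁ C y))

  ↓ : Subset n → Subset n
  ↓ Y = fromDecidable (below? Y)

  ∈↓⁺ : ∀ {Y s y} → y ∈ Y → s ∈ φ₁ C y → s ∈ ↓ Y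
  ∈↓⁺ {Y} y∈Y s∈φy = ∈-fromDecidable⁺ (below? Y) (_ , y∈Y , s∈φy)

  ∈↓⁻ : ∀ {Y s} → s ∈ ↓ Y → Below Y s
  ∈↓⁻ {Y} = ∈-fromDecidable⁻ (below? Y)

  ↓-mono-≪ : ∀ {Z Y} → _≪_ C Z Y → ↓ Z ⊆ ↓ Y
  ↓-mono-≪ Z≪Y s∈↓Z with ∈↓⁻ s∈↓Z
  ... | z , z∈Z , s∈φz with Z≪Y z z∈Z
  ... | y , y∈Y , z∈φy = ∈↓⁺ y∈Y (∈-φ₁-trans s∈φz z∈φy)

  module _ (x : Fin n) (X : Subset n) where

    CoverBelow : Pred (Subset n) _
    CoverBelow Y = _◁_ C x Y × _≪_ C Y X

    coverBelow? : Decidable CoverBelow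
    coverBelow? Y = ◁? x Y ×-dec ≪? Y X

    Optimal : Subset n → Set
    Optimal = LexMinimal CoverBelow (∣_∣ ∘ ↓) ∣_∣

    optimal⇒antichain : ∀ {Y} → Optimal Y →
                        ∀ {y₁ y₂} → y₁ ∈ Y → y₂ ∈ Y → y₁ ∈ φ₁ C y₂ → y₁ ≡ y₂
    optimal⇒antichain {Y} ((x◁Y , Y≪X) , _ , size-min) {y₁} {y₂} y₁∈Y y₂∈Y y₁∈φy₂ with y₂ ≟ y₁
    ... | yes y₂≡y₁ = sym y₂≡y₁
    ... | no  y₂≢y₁ = ⊥-elim (≤⇒≯ ∣Y∣≤∣Y-y₁∣ (x∈p⇒∣p-x∣<∣p∣ y₁∈Y))
      where
      Y-y₁≪Y : _≪_ C (Y - y₁) Y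
      Y-y₁≪Y = ⊆⇒≪ (p─q⊆p Y ⁅ y₁ ⁆)
      ∣Y∣≤∣Y-y₁∣ : ∣ Y ∣ ≤ ∣ Y - y₁ ∣
      ∣Y∣≤∣Y-y₁∣ = size-min (Y - y₁)
        (◁-remove y₁∈φy₂ y₂∈Y y₂≢y₁ x◁Y , ≪-trans Y-y₁≪Y Y≪X)
        (p⊆q⇒∣p∣≤∣q∣ (↓-mono-≪ Y-y₁≪Y))

    optimal⇒minimalCover : Reduced C → ∀ {Y} → Optimal Y → MinimalCover C x Y
    optimal⇒minimalCover reduced {Y} opt@((x◁Y , Y≪X) , ↓-min , _) = x◁Y , minimal
      where
      ↓-stable : ∀ {Z} → _◁_ C x Z → _≪_ C Z Y → ↓ Y ⊆ ↓ Z
      ↓-stable x◁Z Z≪Y = p⊆q∧∣q∣≤∣p∣⇒q⊆p (↓-mono-≪ Z≪Y) (↓-min _ (x◁Z , ≪-trans Z≪Y Y≪X))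

      minimal : ∀ Z → _◁_ C x Z → _≪_ C Z Y → Y ⊆ Z
      minimal Z x◁Z Z≪Y {y} y∈Y with ∈↓⁻ (↓-stable x◁Z Z≪Y (∈↓⁺ y∈Y (∈-φ₁ y)))
      ... | z , z∈Z , y∈φz with Z≪Y z z∈Z
      ... | y′ , y′∈Y , z∈φy′ with optimal⇒antichain opt y∈Y y′∈Y (∈-φ₁-trans y∈φz z∈φy′)
      ... | refl = subst (_∈ Z) (reduced z y (∈-φ₁-antisym z∈φy′ y∈φz)) z∈Z

lemma6 : (m : ℕ) (C : ClosureSystem (suc m)) → Reduced C →
         (x : Fin (suc m)) (X : Subset (suc m)) → _◁_ C x X →
         ∃ λ (Y : Subset (suc m)) → _◁_ C x Y × _≪_ C Y X × MinimalCover C x Y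
lemma6 m C reduced x X x◁X =
  conclude (lex-argmin (coverBelow? C x X) (∣_∣ ∘ ↓ C) ∣_∣ (X , x◁X , ⊆⇒≪ C ⊆-refl))
  where
  conclude : ∃ (Optimal C x X) → ∃ λ Y → _◁_ C x Y × _≪_ C Y X × MinimalCover C x Y
  conclude (Y , opt@((x◁Y , Y≪X) , _)) = Y , x◁Y , Y≪X , optimal⇒minimalCover C x X reduced opt
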